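{- Let $f:[n]\to[n]$ be a Hessenberg function with bounce number $b(f)=3$. Let $R$ be an $f$-tableau of shape $(m,m,m)$ and $S$ an $f$-tableau of shape $\lambda=(\lambda_1,\lambda_2,\lambda_3)$ (a partition with $\lambda_1\ge\lambda_2\ge\lambda_3\ge0$), where $R$ and $S$ together use each element of $[n]$ exactly once. Let $T=R\cup S$ be the tableau of shape $(\lambda_1+m,\lambda_2+m,\lambda_3+m)$ whose first $m$ columns form $R$ and whose remaining columns form $S$. Then $T$ is an $f$-tableau.
   Context: A Hessenberg function is a non-decreasing $f:[n]\to[n]$ with $i\le f(i)$; $P(f)$ is the poset on $[n]$ with $i\prec_f j$ iff $f(i)<j$. The bounce number: set $x_1=f(1)$, $x_{l+1}=f(x_l+1)$ while $x_l<n$; $b(f)$ is the $k$ with $x_k=n$. An $f$-tableau of a shape (Young diagram in English convention) is a filling with distinct elements of $[n]$ such that (i) each column is strictly increasing from top to bottom with respect to $\prec_f$, and (ii) whenever $i$ and $j$ are adjacent in a row with $j$ immediately to the right of $i$, we do not have $j\prec_f i$. (For the lemma, the fillings $R$ and $S$ use disjoint sets of entries whose union is $[n]$.) -}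

module Defs where

open import Data.Nat using (ℕ; zero; suc; _≤_; _<_)
open import Data.List using (List; []; _∷_; map; concat; length; upTo)
open import Data.List.Relation.Unary.All using (All)
open import Data.List.Relation.Unary.Unique.Propositional using (Unique)
open import Data.Maybe using (Maybe; just; nothing)
open import Data.Product using (_×_)
open import Data.Empty using (⊥)
open import Relation.Nullary using (¬_)
open import Relation.Binary.PropositionalEquality using (_≡_)

[_] : ℕ → List ℕ
[ n ] = map suc (upTo n)

-- f : ℕ → ℕ is a Hessenberg function on [n] (values of f outside [n] are irrelevant)
record IsHessenberg (n : ℕ) (f : ℕ → ℕ) : Set where
  field
    mono    : ∀ i j → 1 ≤ i → i ≤ j → j ≤ n → f i ≤ f j
    above   : ∀ i → 1 ≤ i → i ≤ n → i ≤ f i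
    bounded : ∀ i → 1 ≤ i → i ≤ n → f i ≤ n

_≺[_]_ : ℕ → (ℕ → ℕ) → ℕ → Set
i ≺[ f ] j = f i < j

-- BounceFrom f n x k : starting with x_l = x, the sequence reaches n after exactly
-- k terms (counting x itself), where x_{l+1} = f (x_l + 1) while x_l < n.
BounceFrom : (ℕ → ℕ) → ℕ → ℕ → ℕ → Set
BounceFrom f n x zero = ⊥
BounceFrom f n x (suc zero) = x ≡ n
BounceFrom f n x (suc (suc k)) = (x < n) × BounceFrom f n (f (suc x)) (suc k)

BounceNumber : (ℕ → ℕ) → ℕ → ℕ → Set
BounceNumber f n k = BounceFrom f n (f 1) k

at : {A : Set} → List A → ℕ → Maybe A
at [] _ = nothing
at (x ∷ xs) zero = just x
at (x ∷ xs) (suc c) = at xs c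

-- a filling is a list of rows (English convention, row 0 on top);
-- entry T r c is the entry in row r, column c (0-based), if that cell exists
entry : List (List ℕ) → ℕ → ℕ → Maybe ℕ
entry T r c with at T r
... | nothing = nothing
... | just row = at row c

shape : List (List ℕ) → List ℕ
shape T = map length T

record IsFTableau (n : ℕ) (f : ℕ → ℕ) (T : List (List ℕ)) : Set where
  field
    distinct : Unique (concat T)
    inRange  : All (λ i → 1 ≤ i × i ≤ n) (concat T)
    columns  : ∀ r r' c a b → r < r' → entry T r c ≡ just a → entry T r' c ≡ just b
               → a ≺[ f ] b
    rows     : ∀ r c a b → entry T r c ≡ just a → entry T r (suc c) ≡ just b
               → ¬ (b ≺[ f ] a)

module Submission where

-- Write x₀ = 0 and x_{k+1} = f (x_k + 1) for the bounce sequence of f, so that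
-- b(f) = K means x_K = n.  Monotonicity of f gives two one-step facts: an element
-- that precedes (≺_f) something ≤ x_{k+1} is itself ≤ x_k, and an element preceded
-- by something > x_k is itself > x_{k+1}.  Iterating them along columns:
--   * in a rectangular f-tableau with K rows, every entry of row r is ≤ x_{r+1}
--     (the r-th entry of a column has K-1-r entries below it);
--   * in a Young-shaped f-tableau, every entry of row r is > x_r
--     (it has r entries above it).
-- Hence if a ends row r of the rectangle R and b starts row r of S, then
-- a ≤ x_{r+1} ≤ f b, i.e. b ⊀_f a: the only new row adjacencies of R ∥ S are
-- allowed, while the columns of R ∥ S are those of R and of S.  Distinctness and
-- range follow because the entries of R ∥ S are a permutation of those of R and S.

open import Defs
open import Data.Nat using (ℕ; zero; suc; _≤_; _<_; _≥_; _∸_; _+_; z≤n; s≤s; _≤?_)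
open import Data.Nat.Properties
  using (≤-trans; ≤-<-trans; <-≤-trans; <-trans; <⇒≱; ≤⇒≯; ≰⇒>; ≤-antisym; n<1+n; n∸n≡0;
         +-∸-assoc; +-suc; +-identityʳ; m≤m+n; m≤n⇒∃[o]m+o≡n; suc-injective)
open import Data.List using (List; []; _∷_; _++_; length; concat; replicate; zipWith)
open import Data.List.Properties using (∷-injective; ++-assoc; ++-identityʳ)
import Data.List.Relation.Unary.All as All
import Data.List.Relation.Unary.All.Properties as AllP
open import Data.List.Relation.Unary.Any using (here; there)
open import Data.List.Relation.Unary.Linked using (Linked; []; [-]; _∷_)
open import Data.List.Relation.Unary.Unique.Propositional using (Unique)
import Data.List.Relation.Unary.Unique.Propositional.Properties as Unique
open import Data.List.Membership.Propositional using (_∈_)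
open import Data.List.Membership.Propositional.Properties using (∈-concat⁺′)
open import Data.List.Relation.Binary.Permutation.Propositional
  using (_↭_; ↭-refl; ↭-sym; ↭-trans; ↭-reflexive; ↭⇒↭ₛ; module PermutationReasoning)
import Data.List.Relation.Binary.Permutation.Propositional.Properties as ↭
import Data.List.Relation.Binary.Permutation.Setoid.Properties as ↭ₛ
open import Data.Maybe using (just)
open import Data.Product using (_×_; _,_; ∃; ∃₂; proj₁; proj₂)
open import Data.Sum using (_⊎_; inj₁; inj₂)
open import Data.Empty using (⊥-elim)
open import Relation.Nullary using (¬_; yes; no)
open import Relation.Binary.PropositionalEquality
  using (_≡_; refl; sym; trans; cong; cong₂; subst; setoid; module ≡-Reasoning)

-- The bounce sequence x₀ = 0, x_{k+1} = f (x_k + 1); b(f) = K says bounce f K ≡ n.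
bounce : (ℕ → ℕ) → ℕ → ℕ
bounce f zero    = 0
bounce f (suc k) = f (suc (bounce f k))

module BounceSteps {n : ℕ} {f : ℕ → ℕ} (H : IsHessenberg n f) where
  open IsHessenberg H using (mono)

  bounce-≤-f : ∀ k y → bounce f k < y → y ≤ n → bounce f (suc k) ≤ f y
  bounce-≤-f k y xₖ<y y≤n = mono (suc (bounce f k)) y (s≤s z≤n) xₖ<y y≤n

  below-bounce : ∀ k a q → a ≤ n → a ≺[ f ] q → q ≤ bounce f (suc k) → a ≤ bounce f k
  below-bounce k a q a≤n a≺q q≤xₖ₊₁ with a ≤? bounce f k
  ... | yes a≤xₖ = a≤xₖ
  ... | no  a≰xₖ = ⊥-elim (<⇒≱ a≺q (≤-trans q≤xₖ₊₁ (bounce-≤-f k a (≰⇒> a≰xₖ) a≤n)))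

  above-bounce : ∀ k p b → bounce f k < p → p ≤ n → p ≺[ f ] b → bounce f (suc k) < b
  above-bounce k p b xₖ<p p≤n p≺b = ≤-<-trans (bounce-≤-f k p xₖ<p p≤n) p≺b

at-length : {A : Set} (xs : List A) {c : ℕ} {a : A} → at xs c ≡ just a → c < length xs
at-length (x ∷ xs) {zero}  _ = s≤s z≤n
at-length (x ∷ xs) {suc c} e = s≤s (at-length xs e)

at-defined : {A : Set} (xs : List A) {c : ℕ} → c < length xs → ∃ λ a → at xs c ≡ just a
at-defined (x ∷ xs) {zero}  _         = x , refl
at-defined (x ∷ xs) {suc c} (s≤s c<) = at-defined xs c<

at-∈ : {A : Set} (xs : List A) {c : ℕ} {a : A} → at xs c ≡ just a → a ∈ xs
at-∈ (x ∷ xs) {zero}  refl = here refl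
at-∈ (x ∷ xs) {suc c} e    = there (at-∈ xs e)

at-++ : (xs ys : List ℕ) {c a : ℕ} → at (xs ++ ys) c ≡ just a →
  (c < length xs × at xs c ≡ just a) ⊎ (length xs ≤ c × at ys (c ∸ length xs) ≡ just a)
at-++ []       ys         e = inj₂ (z≤n , e)
at-++ (x ∷ xs) ys {zero}  e = inj₁ (s≤s z≤n , e)
at-++ (x ∷ xs) ys {suc c} e with at-++ xs ys e
... | inj₁ (c< , e′) = inj₁ (s≤s c< , e′)
... | inj₂ (≤c , e′) = inj₂ (s≤s ≤c , e′)

at-zipWith : {A B C : Set} (g : A → B → C) (xs : List A) (ys : List B) {r : ℕ} {z : C} →
  at (zipWith g xs ys) r ≡ just z → ∃₂ λ x y → at xs r ≡ just x × at ys r ≡ just y × z ≡ g x y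
at-zipWith g (x ∷ xs) (y ∷ ys) {zero}  refl = x , y , refl , refl , refl
at-zipWith g (x ∷ xs) (y ∷ ys) {suc r} e    = at-zipWith g xs ys e

entry-row : (T : List (List ℕ)) {r c a : ℕ} → entry T r c ≡ just a →
  ∃ λ row → at T r ≡ just row × at row c ≡ just a
entry-row T {r} e with at T r
... | just row = row , refl , e

entry-cell : (T : List (List ℕ)) {r c a : ℕ} {row : List ℕ} →
  at T r ≡ just row → at row c ≡ just a → entry T r c ≡ just a
entry-cell T {r} eT e with at T r
entry-cell T refl e | just row = e

entry-∈ : (T : List (List ℕ)) {r c a : ℕ} → entry T r c ≡ just a → a ∈ concat T
entry-∈ T e with entry-row T e
... | row , eT , e′ = ∈-concat⁺′ (at-∈ row e′) (at-∈ T eT)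

Rectangular : ℕ → List (List ℕ) → Set
Rectangular m T = shape T ≡ replicate (length T) m

YoungShaped : List (List ℕ) → Set
YoungShaped T = ∀ r c b → entry T (suc r) c ≡ just b → ∃ λ a → entry T r c ≡ just a

rectangular-row-length : ∀ {m} (T : List (List ℕ)) {r} {row : List ℕ} → Rectangular m T →
  at T r ≡ just row → length row ≡ m
rectangular-row-length (x ∷ T) {zero}  rect refl = proj₁ (∷-injective rect)
rectangular-row-length (x ∷ T) {suc r} rect e    = rectangular-row-length T (proj₂ (∷-injective rect)) e

rectangular-cell : ∀ {m} (T : List (List ℕ)) {r r′ c a : ℕ} → Rectangular m T →
  entry T r c ≡ just a → r′ < length T → ∃ λ b → entry T r′ c ≡ just b
rectangular-cell T {c = c} rect e r′< with entry-row T e | at-defined T r′<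
... | row , eT , e′ | row′ , eT′ = proj₁ cell , entry-cell T eT′ (proj₂ cell)
  where
  same-length : length row ≡ length row′
  same-length = trans (rectangular-row-length T rect eT) (sym (rectangular-row-length T rect eT′))
  cell : ∃ λ b → at row′ c ≡ just b
  cell = at-defined row′ (subst (c <_) same-length (at-length row e′))

longer-row-above : (T : List (List ℕ)) {r : ℕ} {row : List ℕ} → Linked _≥_ (shape T) →
  at T (suc r) ≡ just row → ∃ λ row′ → at T r ≡ just row′ × length row ≤ length row′
longer-row-above (x ∷ y ∷ T) {zero}  (y≤x ∷ _)   refl = x , refl , y≤x
longer-row-above (x ∷ y ∷ T) {suc r} (_ ∷ sorted) e    = longer-row-above (y ∷ T) sorted e

partition-young : (T : List (List ℕ)) → Linked _≥_ (shape T) → YoungShaped T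
partition-young T sorted r c b e with entry-row T e
... | row , eT , e′ with longer-row-above T sorted eT
... | row′ , eT′ , len≤ with at-defined row′ (<-≤-trans (at-length row e′) len≤)
... | a , e″ = a , entry-cell T eT′ e″

_∥_ : List (List ℕ) → List (List ℕ) → List (List ℕ)
R ∥ S = zipWith _++_ R S

entry-∥ : ∀ {m} (R S : List (List ℕ)) {r c a : ℕ} → Rectangular m R → entry (R ∥ S) r c ≡ just a →
  (c < m × entry R r c ≡ just a) ⊎ (m ≤ c × entry S r (c ∸ m) ≡ just a)
entry-∥ R S rect e with entry-row (R ∥ S) e
... | _ , eT , e′ with at-zipWith _++_ R S eT
... | u , v , eR , eS , refl with rectangular-row-length R rect eR | at-++ u v e′
... | refl | inj₁ (c< , eu) = inj₁ (c< , entry-cell R eR eu)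
... | refl | inj₂ (≤c , ev) = inj₂ (≤c , entry-cell S eS ev)

concat-∥ : (R S : List (List ℕ)) → length R ≡ length S → concat (R ∥ S) ↭ concat R ++ concat S
concat-∥ []      []      _   = ↭-refl
concat-∥ (u ∷ R) (v ∷ S) len = begin
  (u ++ v) ++ concat (R ∥ S)       ≡⟨ ++-assoc u v _ ⟩
  u ++ v ++ concat (R ∥ S)         ↭⟨ ↭.++⁺ˡ u (↭.++⁺ˡ v (concat-∥ R S (suc-injective len))) ⟩
  u ++ v ++ concat R ++ concat S   ↭⟨ ↭.++⁺ˡ u (↭.shifts v (concat R)) ⟩
  u ++ concat R ++ v ++ concat S   ≡⟨ ++-assoc u (concat R) _ ⟨
  (u ++ concat R) ++ v ++ concat S ∎
  where open PermutationReasoning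

module ColumnBounds {n : ℕ} {f : ℕ → ℕ} (H : IsHessenberg n f)
                    {T : List (List ℕ)} (T-tab : IsFTableau n f T) where
  open BounceSteps H
  open IsFTableau T-tab

  entry-≤n : ∀ {r c a} → entry T r c ≡ just a → a ≤ n
  entry-≤n e = proj₂ (All.lookup inRange (entry-∈ T e))

  -- induction on the depth d of row r above the bottom row r + d of the rectangle
  rectangle-bound-by-depth : ∀ {m} → Rectangular m T → bounce f (length T) ≡ n →
    ∀ d r {c a} → suc (r + d) ≡ length T → entry T r c ≡ just a → a ≤ bounce f (suc r)
  rectangle-bound-by-depth rect xK≡n zero r bottom e = subst (_ ≤_) n≡xᵣ₊₁ (entry-≤n e)
    where
    open ≡-Reasoning
    n≡xᵣ₊₁ : n ≡ bounce f (suc r)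
    n≡xᵣ₊₁ = begin
      n                       ≡⟨ xK≡n ⟨
      bounce f (length T)     ≡⟨ cong (bounce f) bottom ⟨
      bounce f (suc (r + 0))  ≡⟨ cong (λ k → bounce f (suc k)) (+-identityʳ r) ⟩
      bounce f (suc r)        ∎
  rectangle-bound-by-depth rect xK≡n (suc d) r {c} {a} bottom e =
    below-bounce (suc r) a q (entry-≤n e) (columns r (suc r) c a q (n<1+n r) e e′)
      (rectangle-bound-by-depth rect xK≡n d (suc r) bottom′ e′)
    where
    bottom′ : suc (suc r + d) ≡ length T
    bottom′ = trans (cong suc (sym (+-suc r d))) bottom
    cell-below : ∃ λ q → entry T (suc r) c ≡ just q
    cell-below = rectangular-cell T rect e (subst (suc (suc r) ≤_) bottom′ (m≤m+n (suc (suc r)) d))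
    q = proj₁ cell-below
    e′ = proj₂ cell-below

  rectangle-bound : ∀ {m} → Rectangular m T → bounce f (length T) ≡ n →
    ∀ {r c a} → entry T r c ≡ just a → a ≤ bounce f (suc r)
  rectangle-bound rect xK≡n {r} e with entry-row T e
  ... | _ , eT , _ with m≤n⇒∃[o]m+o≡n (at-length T eT)
  ... | d , bottom = rectangle-bound-by-depth rect xK≡n d r bottom e

  young-bound : YoungShaped T → ∀ r {c b} → entry T r c ≡ just b → bounce f r < b
  young-bound young zero    e = proj₁ (All.lookup inRange (entry-∈ T e))
  young-bound young (suc r) e with young r _ _ e
  ... | a , e′ = above-bounce r a _ (young-bound young r e′) (entry-≤n e′)
                   (columns r (suc r) _ a _ (n<1+n r) e′ e)

juxtaposition : (n : ℕ) (f : ℕ → ℕ) → IsHessenberg n f → (m : ℕ) (R S : List (List ℕ)) →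
  bounce f (length R) ≡ n → length R ≡ length S →
  IsFTableau n f R → Rectangular m R → IsFTableau n f S → YoungShaped S →
  concat R ++ concat S ↭ [ n ] → IsFTableau n f (R ∥ S)
juxtaposition n f H m R S xK≡n len R-tab R-rect S-tab S-young entries↭ = record
  { distinct = ↭ₛ.Unique-resp-↭ (setoid ℕ) (↭⇒↭ₛ (↭-sym (↭-trans RS↭ entries↭))) [n]-unique
  ; inRange  = ↭.All-resp-↭ (↭-sym RS↭) (AllP.++⁺ R.inRange S.inRange)
  ; columns  = columns-∥
  ; rows     = rows-∥
  }
  where
  module R = IsFTableau R-tab
  module S = IsFTableau S-tab
  open BounceSteps H using (bounce-≤-f)
  open ColumnBounds H R-tab using (rectangle-bound)
  open ColumnBounds H S-tab using (young-bound; entry-≤n)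

  RS↭ : concat (R ∥ S) ↭ concat R ++ concat S
  RS↭ = concat-∥ R S len

  [n]-unique : Unique [ n ]
  [n]-unique = Unique.map⁺ suc-injective (Unique.upTo⁺ n)

  columns-∥ : ∀ r r′ c a b → r < r′ → entry (R ∥ S) r c ≡ just a → entry (R ∥ S) r′ c ≡ just b →
    a ≺[ f ] b
  columns-∥ r r′ c a b r<r′ ea eb with entry-∥ R S R-rect ea | entry-∥ R S R-rect eb
  ... | inj₁ (_ , ea′) | inj₁ (_ , eb′) = R.columns r r′ c a b r<r′ ea′ eb′
  ... | inj₂ (_ , ea′) | inj₂ (_ , eb′) = S.columns r r′ (c ∸ m) a b r<r′ ea′ eb′
  ... | inj₁ (c<m , _) | inj₂ (m≤c , _) = ⊥-elim (<⇒≱ c<m m≤c)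
  ... | inj₂ (m≤c , _) | inj₁ (c<m , _) = ⊥-elim (<⇒≱ c<m m≤c)

  -- the new adjacencies: a last in row r of R, b first in row r of S, a ≤ x_{r+1} ≤ f b
  boundary : ∀ r c a b → entry R r c ≡ just a → entry S r 0 ≡ just b → ¬ (b ≺[ f ] a)
  boundary r c a b ea eb =
    ≤⇒≯ (≤-trans (rectangle-bound R-rect xK≡n ea) (bounce-≤-f r b (young-bound S-young r eb) (entry-≤n eb)))

  rows-∥ : ∀ r c a b → entry (R ∥ S) r c ≡ just a → entry (R ∥ S) r (suc c) ≡ just b →
    ¬ (b ≺[ f ] a)
  rows-∥ r c a b ea eb with entry-∥ R S R-rect ea | entry-∥ R S R-rect eb
  ... | inj₁ (_ , ea′)   | inj₁ (_ , eb′)   = R.rows r c a b ea′ eb′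
  ... | inj₂ (m≤c , ea′) | inj₂ (_ , eb′)   =
        S.rows r (c ∸ m) a b ea′ (subst (λ c′ → entry S r c′ ≡ just b) (+-∸-assoc 1 m≤c) eb′)
  ... | inj₂ (m≤c , _)   | inj₁ (c+1<m , _) = ⊥-elim (<⇒≱ (<-trans (n<1+n c) c+1<m) m≤c)
  ... | inj₁ (c<m , ea′) | inj₂ (m≤c+1 , eb′) =
        boundary r c a b ea′ (subst (λ c′ → entry S r c′ ≡ just b) c+1∸m≡0 eb′)
    where
    c+1∸m≡0 : suc c ∸ m ≡ 0
    c+1∸m≡0 = trans (cong (suc c ∸_) (≤-antisym m≤c+1 c<m)) (n∸n≡0 (suc c))

-- Lemma 4.3: the case K = 3; b(f) = 3 gives x₃ = n, and S has partition shape λ.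
lemma4p3 : (n : ℕ) (f : ℕ → ℕ) → IsHessenberg n f → BounceNumber f n 3 →
    (m l₁ l₂ l₃ : ℕ) → l₂ ≤ l₁ → l₃ ≤ l₂ →
    (R₁ R₂ R₃ S₁ S₂ S₃ : List ℕ) →
    IsFTableau n f (R₁ ∷ R₂ ∷ R₃ ∷ []) → shape (R₁ ∷ R₂ ∷ R₃ ∷ []) ≡ m ∷ m ∷ m ∷ [] →
    IsFTableau n f (S₁ ∷ S₂ ∷ S₃ ∷ []) → shape (S₁ ∷ S₂ ∷ S₃ ∷ []) ≡ l₁ ∷ l₂ ∷ l₃ ∷ [] →
    (R₁ ++ R₂ ++ R₃ ++ S₁ ++ S₂ ++ S₃) ↭ [ n ] →
    IsFTableau n f ((R₁ ++ S₁) ∷ (R₂ ++ S₂) ∷ (R₃ ++ S₃) ∷ [])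
lemma4p3 n f H (_ , _ , x₃≡n) m l₁ l₂ l₃ l₂≤l₁ l₃≤l₂ R₁ R₂ R₃ S₁ S₂ S₃
         R-tab R-shape S-tab S-shape entries↭ =
  juxtaposition n f H m R S x₃≡n refl R-tab R-shape S-tab S-young
    (↭-trans (↭-reflexive entries-of-rows) entries↭)
  where
  R = R₁ ∷ R₂ ∷ R₃ ∷ []
  S = S₁ ∷ S₂ ∷ S₃ ∷ []

  S-young : YoungShaped S
  S-young = partition-young S (subst (Linked _≥_) (sym S-shape) (l₂≤l₁ ∷ l₃≤l₂ ∷ [-]))

  entries-of-rows : concat R ++ concat S ≡ R₁ ++ R₂ ++ R₃ ++ S₁ ++ S₂ ++ S₃
  entries-of-rows = begin
    (R₁ ++ R₂ ++ R₃ ++ []) ++ S₁ ++ S₂ ++ S₃ ++ []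
      ≡⟨ cong₂ (λ xs ys → (R₁ ++ R₂ ++ xs) ++ S₁ ++ S₂ ++ ys) (++-identityʳ R₃) (++-identityʳ S₃) ⟩
    (R₁ ++ R₂ ++ R₃) ++ S₁ ++ S₂ ++ S₃  ≡⟨ ++-assoc R₁ (R₂ ++ R₃) _ ⟩
    R₁ ++ (R₂ ++ R₃) ++ S₁ ++ S₂ ++ S₃  ≡⟨ cong (R₁ ++_) (++-assoc R₂ R₃ _) ⟩
    R₁ ++ R₂ ++ R₃ ++ S₁ ++ S₂ ++ S₃    ∎
    where open ≡-Reasoning
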